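{- Let $K$ be a field of characteristic $0$, $e\ge 2$, $A,B\in M_e(K)$ and $d\in(\mathbb{Z}/e\mathbb{Z})^\times$. Then $\mathrm{Char}_X(B\overset{d}{\ast}A)=\mathrm{Char}_X(A\overset{d^{ -1}}{\ast}B)$, where $\mathrm{Char}_X$ denotes the characteristic polynomial.
   Context: For $A=[a_{i,j}]$, $B=[b_{i,j}]\in M_e(K)$ (indices read modulo $e$) and $d\in\mathbb{Z}/e\mathbb{Z}\setminus\{0\}$, the $d$-composition is $A\overset{d}{\ast}B=\big[\sum_{s=0}^{e-1}\sum_{t=0}^{e-1}a_{s,t}b_{ds+i,dt+j}\big]_{0\le i,j\le e-1}$. -}

module Defs where

open import Level using (Level; _⊔_)
open import Data.Nat as ℕ using (ℕ; zero; suc; NonZero)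
open import Data.Nat.DivMod using (_mod_)
open import Data.Fin using (Fin; zero; suc; toℕ; punchIn; _≟_)
open import Data.List using (List; []; _∷_)
open import Data.Product using (Σ; _×_; _,_)
open import Relation.Nullary using (¬_; yes; no)
open import Algebra.Bundles using (CommutativeRing)

record IsField {c ℓ : Level} (R : CommutativeRing c ℓ) : Set (c ⊔ ℓ) where
  open CommutativeRing R using (Carrier; _≈_; _*_; 0#; 1#)
  field
    1≉0     : ¬ (1# ≈ 0#)
    inverse : ∀ x → ¬ (x ≈ 0#) → Σ Carrier (λ y → x * y ≈ 1#)

module _ {c ℓ : Level} (R : CommutativeRing c ℓ) where
  open CommutativeRing R using (Carrier; _≈_; _+_; 0#; 1#)

  natCast : ℕ → Carrier
  natCast zero    = 0#
  natCast (suc n) = 1# + natCast n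

  CharZero : Set ℓ
  CharZero = ∀ n → ¬ (natCast (suc n) ≈ 0#)

Mat : {a : Level} → Set a → ℕ → Set a
Mat A e = Fin e → Fin e → A

module MatrixOps {c ℓ : Level} (R : CommutativeRing c ℓ) where
  open CommutativeRing R using (Carrier; _≈_; _+_; _*_; -_; 0#; 1#)

  sumFin : ∀ {e} → (Fin e → Carrier) → Carrier
  sumFin {zero}  f = 0#
  sumFin {suc e} f = f zero + sumFin (λ i → f (suc i))

  affMod : ∀ {e} .{{_ : NonZero e}} → Fin e → Fin e → Fin e → Fin e
  affMod {e} d s i = (toℕ d ℕ.* toℕ s ℕ.+ toℕ i) mod e

  dComp : ∀ {e} .{{_ : NonZero e}} → Fin e → Mat Carrier e → Mat Carrier e → Mat Carrier e
  dComp d A B i j = sumFin (λ s → sumFin (λ t → A s t * B (affMod d s i) (affMod d t j)))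

  IsInverseMod : ∀ {e} .{{_ : NonZero e}} → Fin e → Fin e → Set
  IsInverseMod {e} d d' = toℕ ((toℕ d ℕ.* toℕ d') mod e) ≡ℕ 1
    where open import Relation.Binary.PropositionalEquality renaming (_≡_ to _≡ℕ_)

  -- Polynomials over R: coefficient lists, lowest degree first.
  Poly : Set c
  Poly = List Carrier

  infixl 6 _+ₚ_
  infixl 7 _*ₚ_ _·ₚ_

  _+ₚ_ : Poly → Poly → Poly
  []       +ₚ q        = q
  (a ∷ p)  +ₚ []       = a ∷ p
  (a ∷ p)  +ₚ (b ∷ q)  = (a + b) ∷ (p +ₚ q)

  -ₚ_ : Poly → Poly
  -ₚ []      = []
  -ₚ (a ∷ p) = (- a) ∷ (-ₚ p)

  _·ₚ_ : Carrier → Poly → Poly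
  a ·ₚ []      = []
  a ·ₚ (b ∷ p) = (a * b) ∷ (a ·ₚ p)

  _*ₚ_ : Poly → Poly → Poly
  []      *ₚ q = []
  (a ∷ p) *ₚ q = (a ·ₚ q) +ₚ (0# ∷ (p *ₚ q))

  constₚ : Carrier → Poly
  constₚ a = a ∷ []

  0ₚ 1ₚ Xₚ : Poly
  0ₚ = []
  1ₚ = 1# ∷ []
  Xₚ = 0# ∷ 1# ∷ []

  -- equality of polynomials: coefficientwise, missing coefficients are 0
  IsZeroₚ : Poly → Set ℓ
  IsZeroₚ []      = Lift0
    where open import Data.Unit.Polymorphic using () renaming (⊤ to Lift0)
  IsZeroₚ (a ∷ p) = (a ≈ 0#) × IsZeroₚ p

  infix 4 _≈ₚ_
  _≈ₚ_ : Poly → Poly → Set ℓ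
  []      ≈ₚ q       = IsZeroₚ q
  (a ∷ p) ≈ₚ []      = IsZeroₚ (a ∷ p)
  (a ∷ p) ≈ₚ (b ∷ q) = (a ≈ b) × (p ≈ₚ q)

  minor : ∀ {n} → Mat Poly (suc n) → Fin (suc n) → Mat Poly n
  minor M j r s = M (suc r) (punchIn j s)

  sumFinₚ : ∀ {e} → (Fin e → Poly) → Poly
  sumFinₚ {zero}  f = 0ₚ
  sumFinₚ {suc e} f = f zero +ₚ sumFinₚ (λ i → f (suc i))

  sign : ℕ → Poly → Poly
  sign zero          p = p
  sign (suc zero)    p = -ₚ p
  sign (suc (suc k)) p = sign k p

  detₚ : ∀ {n} → Mat Poly n → Poly
  detₚ {zero}  M = 1ₚ
  detₚ {suc n} M = sumFinₚ (λ j → sign (toℕ j) (M zero j *ₚ detₚ (minor M j)))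

  charPoly : ∀ {e} → Mat Carrier e → Poly
  charPoly M = detₚ (λ i j → diag i j +ₚ (-ₚ constₚ (M i j)))
    where
    diag : ∀ {e} → Fin e → Fin e → Poly
    diag i j with i ≟ j
    ... | yes _ = Xₚ
    ... | no  _ = 0ₚ

-- Substituting u = d s + i and v = d t + j in the double sum defining (B ∗_d A)ᵢⱼ turns it
-- into (A ∗_{d⁻¹} B)_{σ i, σ j} with σ i = −d⁻¹ i, a permutation of ℤ/eℤ. So the two matrices
-- are conjugate by a permutation matrix and have the same characteristic polynomial. For the
-- latter, write the permutation as a product of adjacent transpositions: conjugating by one
-- swaps two adjacent rows and the same two columns, changing the sign of the determinant twice.

module Submission where

open import Level using (Level; _⊔_)
open import Data.Nat as ℕ using (ℕ; zero; suc; _<_; _≤_; z≤n; s≤s; NonZero)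
import Data.Nat.Properties as ℕ
open import Data.Fin using (Fin; zero; suc; toℕ; fromℕ<; inject₁; punchIn; _≟_)
import Data.Fin.Properties as Fin
open import Data.Fin.Permutation using (permutation)
open import Data.List using ([]; _∷_)
open import Data.Product using (Σ-syntax; _,_; proj₁)
open import Data.Sum using (inj₁; inj₂)
open import Data.Empty using (⊥-elim)
open import Function using (id; _∘_)
open import Function.Definitions using (Injective)
open import Relation.Nullary using (¬_; Dec; yes; no)
open import Relation.Binary.PropositionalEquality as ≡ using (_≡_; _≢_)
open import Relation.Binary.Bundles using (Setoid)
open import Relation.Binary.Structures using (IsEquivalence)
open import Algebra.Bundles using (CommutativeRing; CommutativeMonoid)
open import Defs

private
  variable
    m n : ℕ

adjSwap : Fin n → Fin (suc n) → Fin (suc n)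
adjSwap zero    zero          = suc zero
adjSwap zero    (suc zero)    = zero
adjSwap zero    (suc (suc i)) = suc (suc i)
adjSwap (suc k) zero          = zero
adjSwap (suc k) (suc i)       = suc (adjSwap k i)

adjSwap-involutive : (k : Fin n) (i : Fin (suc n)) → adjSwap k (adjSwap k i) ≡ i
adjSwap-involutive zero    zero          = ≡.refl
adjSwap-involutive zero    (suc zero)    = ≡.refl
adjSwap-involutive zero    (suc (suc i)) = ≡.refl
adjSwap-involutive (suc k) zero          = ≡.refl
adjSwap-involutive (suc k) (suc i)       = ≡.cong suc (adjSwap-involutive k i)

adjSwap-inject₁ : (k : Fin n) → adjSwap k (inject₁ k) ≡ suc k
adjSwap-inject₁ zero    = ≡.refl
adjSwap-inject₁ (suc k) = ≡.cong suc (adjSwap-inject₁ k)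

adjSwap-suc : (k : Fin n) → adjSwap k (suc k) ≡ inject₁ k
adjSwap-suc k = ≡.trans (≡.cong (adjSwap k) (≡.sym (adjSwap-inject₁ k))) (adjSwap-involutive k (inject₁ k))

adjSwap-below : (k : Fin n) (i : Fin (suc n)) → toℕ i < toℕ k → adjSwap k i ≡ i
adjSwap-below (suc k) zero    _         = ≡.refl
adjSwap-below (suc k) (suc i) (s≤s i<k) = ≡.cong suc (adjSwap-below k i i<k)

adjSwap-punchIn-suc : (k : Fin n) (c : Fin n) → adjSwap k (punchIn (suc k) c) ≡ punchIn (inject₁ k) c
adjSwap-punchIn-suc zero    zero    = ≡.refl
adjSwap-punchIn-suc zero    (suc c) = ≡.refl
adjSwap-punchIn-suc (suc k) zero    = ≡.refl
adjSwap-punchIn-suc (suc k) (suc c) = ≡.cong suc (adjSwap-punchIn-suc k c)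

adjSwap-punchIn-inject₁ : (k : Fin n) (c : Fin n) → adjSwap k (punchIn (inject₁ k) c) ≡ punchIn (suc k) c
adjSwap-punchIn-inject₁ k c =
  ≡.trans (≡.cong (adjSwap k) (≡.sym (adjSwap-punchIn-suc k c))) (adjSwap-involutive k _)

data AdjSwapView (k : Fin (suc m)) : Fin (suc (suc m)) → Set where
  at-inject₁ : AdjSwapView k (inject₁ k)
  at-suc     : AdjSwapView k (suc k)
  elsewhere  : ∀ {l} (k′ : Fin m) → adjSwap k l ≡ l →
               (∀ c → adjSwap k (punchIn l c) ≡ punchIn l (adjSwap k′ c)) → AdjSwapView k l

adjSwapView : (k : Fin (suc m)) (l : Fin (suc (suc m))) → AdjSwapView k l
adjSwapView           zero    zero          = at-inject₁
adjSwapView           zero    (suc zero)    = at-suc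
adjSwapView {suc m}   zero    (suc (suc l)) = elsewhere zero ≡.refl commute
  where
  commute : ∀ c → adjSwap zero (punchIn (suc (suc l)) c) ≡ punchIn (suc (suc l)) (adjSwap zero c)
  commute zero          = ≡.refl
  commute (suc zero)    = ≡.refl
  commute (suc (suc c)) = ≡.refl
adjSwapView           (suc k) zero          = elsewhere k ≡.refl (λ _ → ≡.refl)
adjSwapView {suc m}   (suc k) (suc l) with adjSwapView k l
... | at-inject₁            = at-inject₁
... | at-suc                = at-suc
... | elsewhere k′ fixed commute = elsewhere (suc k′) (≡.cong suc fixed) commute′
  where
  commute′ : ∀ c → adjSwap (suc k) (punchIn (suc l) c) ≡ punchIn (suc l) (adjSwap (suc k′) c)
  commute′ zero    = ≡.refl
  commute′ (suc c) = ≡.cong suc (commute c)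

-- For j ≢ j′, the increasing enumeration of the indices other than j and j′.
removeTwo : Fin (suc (suc m)) → Fin (suc (suc m)) → Fin m → Fin (suc (suc m))
removeTwo zero    zero     c       = suc (suc c)
removeTwo zero    (suc j′) c       = suc (punchIn j′ c)
removeTwo (suc j) zero     c       = suc (punchIn j c)
removeTwo (suc j) (suc j′) zero    = zero
removeTwo (suc j) (suc j′) (suc c) = suc (removeTwo j j′ c)

removeTwo-comm : (j j′ : Fin (suc (suc m))) (c : Fin m) → removeTwo j j′ c ≡ removeTwo j′ j c
removeTwo-comm zero    zero     c       = ≡.refl
removeTwo-comm zero    (suc j′) c       = ≡.refl
removeTwo-comm (suc j) zero     c       = ≡.refl
removeTwo-comm (suc j) (suc j′) zero    = ≡.refl
removeTwo-comm (suc j) (suc j′) (suc c) = ≡.cong suc (removeTwo-comm j j′ c)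

punchIn-punchIn : (j : Fin (suc (suc m))) (l : Fin (suc m)) (c : Fin m) →
                  punchIn j (punchIn l c) ≡ removeTwo j (punchIn j l) c
punchIn-punchIn zero    l       c       = ≡.refl
punchIn-punchIn (suc j) zero    c       = ≡.refl
punchIn-punchIn (suc j) (suc l) zero    = ≡.refl
punchIn-punchIn (suc j) (suc l) (suc c) = ≡.cong suc (punchIn-punchIn j l c)

-- Has the parity of toℕ j + toℕ j′ − [j < j′]: the sign of the term M₀ⱼ M₁ⱼ′ in the
-- expansion of a determinant along its first two rows.
pairParity : Fin n → Fin n → ℕ
pairParity zero    zero     = 0
pairParity zero    (suc j′) = suc (suc (toℕ j′))
pairParity (suc j) zero     = suc (toℕ j)
pairParity (suc j) (suc j′) = suc (suc (pairParity j j′))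

module SwapInduction {p : Level} {n : ℕ} (P : (Fin (suc n) → Fin (suc n)) → Set p)
  (P-resp : ∀ {σ τ} → (∀ i → σ i ≡ τ i) → P σ → P τ)
  (P-id : P id)
  (P-adjSwap : ∀ k {σ} → P σ → P (adjSwap k ∘ σ)) where

  open import Data.Nat using (_+_)

  private
    FixesBelow : (Fin (suc n) → Fin (suc n)) → ℕ → Set
    FixesBelow σ k = ∀ i → toℕ i < k → σ i ≡ i

    P-unswap : ∀ k {σ} → P (adjSwap k ∘ σ) → P σ
    P-unswap k {σ} = P-resp (λ i → adjSwap-involutive k (σ i)) ∘ P-adjSwap k

    fixesBelow-suc : ∀ {σ k} (k<n : k < suc n) → FixesBelow σ k →
                     σ (fromℕ< k<n) ≡ fromℕ< k<n → FixesBelow σ (suc k)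
    fixesBelow-suc {σ} {k} k<n fixed σk≡k i (s≤s i≤k) with ℕ.m≤n⇒m<n∨m≡n i≤k
    ... | inj₁ i<k = fixed i i<k
    ... | inj₂ i≡k = ≡.trans (≡.cong σ i≡k′) (≡.trans σk≡k (≡.sym i≡k′))
      where i≡k′ = Fin.toℕ-injective (≡.trans i≡k (≡.sym (Fin.toℕ-fromℕ< k<n)))

    moved-above : ∀ {σ k} (k<n : k < suc n) → Injective _≡_ _≡_ σ → FixesBelow σ k →
                  σ (fromℕ< k<n) ≢ fromℕ< k<n → k < toℕ (σ (fromℕ< k<n))
    moved-above {σ} {k} k<n inj fixed σk≢k = ℕ.≤∧≢⇒< (ℕ.≮⇒≥ not-below) not-at
      where
      not-below : ¬ (toℕ (σ (fromℕ< k<n)) < k)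
      not-below σk<k = σk≢k (inj (fixed _ σk<k))
      not-at : k ≢ toℕ (σ (fromℕ< k<n))
      not-at k≡σk = σk≢k (Fin.toℕ-injective (≡.trans (≡.sym k≡σk) (≡.sym (Fin.toℕ-fromℕ< k<n))))

    -- Lowers the value σ k to k by composing with adjacent swaps on the left; u bounds the
    -- number of swaps still needed.
    settle : ∀ k (k<n : k < suc n) → (∀ σ → Injective _≡_ _≡_ σ → FixesBelow σ (suc k) → P σ) →
             ∀ u σ → Injective _≡_ _≡_ σ → FixesBelow σ k → toℕ (σ (fromℕ< k<n)) ≤ u + k → P σ
    settle k k<n next u σ inj fixed bound with σ (fromℕ< k<n) ≟ fromℕ< k<n
    ... | yes σk≡k = next σ inj (fixesBelow-suc k<n fixed σk≡k)
    ... | no  σk≢k = descend u (σ (fromℕ< k<n)) ≡.refl (moved-above k<n inj fixed σk≢k) bound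
      where
      descend : ∀ u m → σ (fromℕ< k<n) ≡ m → k < toℕ m → toℕ m ≤ u + k → P σ
      descend zero     (suc m′) _   (s≤s k≤m′) m≤k   = ⊥-elim (ℕ.<⇒≱ (s≤s k≤m′) m≤k)
      descend (suc u′) (suc m′) σk≡ (s≤s k≤m′) m≤u+k = P-unswap m′ (settle k k<n next u′ σ′ inj′ fixed′ bound′)
        where
        σ′ = adjSwap m′ ∘ σ
        inj′ : Injective _≡_ _≡_ σ′
        inj′ {a} {b} eq = inj (≡.trans (≡.sym (adjSwap-involutive m′ (σ a)))
                                (≡.trans (≡.cong (adjSwap m′) eq) (adjSwap-involutive m′ (σ b))))
        fixed′ : FixesBelow σ′ k
        fixed′ i i<k = ≡.trans (≡.cong (adjSwap m′) (fixed i i<k)) (adjSwap-below m′ i (ℕ.<-≤-trans i<k k≤m′))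
        σ′k≡m′ : toℕ (σ′ (fromℕ< k<n)) ≡ toℕ m′
        σ′k≡m′ = ≡.trans (≡.cong (toℕ ∘ adjSwap m′) σk≡)
                           (≡.trans (≡.cong toℕ (adjSwap-suc m′)) (Fin.toℕ-inject₁ m′))
        bound′ : toℕ (σ′ (fromℕ< k<n)) ≤ u′ + k
        bound′ = ≡.subst (_≤ u′ + k) (≡.sym σ′k≡m′) (ℕ.≤-pred m≤u+k)

    sort : ∀ r k → r + k ≡ suc n → ∀ σ → Injective _≡_ _≡_ σ → FixesBelow σ k → P σ
    sort zero    k r+k≡ σ _ fixed =
      P-resp (λ i → ≡.sym (fixed i (≡.subst (toℕ i <_) (≡.sym r+k≡) (Fin.toℕ<n i)))) P-id
    sort (suc r) k r+k≡ σ inj fixed =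
      settle k k<n (sort r (suc k) (≡.trans (ℕ.+-suc r k) r+k≡)) _ σ inj fixed (ℕ.m≤m+n _ k)
      where
      k<n : k < suc n
      k<n = ≡.subst (k <_) r+k≡ (ℕ.m<n+m k (s≤s z≤n))

  swap-induction : ∀ σ → Injective _≡_ _≡_ σ → P σ
  swap-induction σ inj = sort (suc n) 0 (ℕ.+-identityʳ _) σ inj (λ _ ())

-- Congruence modulo e = suc S, in which S plays the role of −1.
module Modular (S : ℕ) where
  open import Data.Nat using (_+_; _*_; _%_)
  open import Data.Nat.DivMod using (_mod_; m%n%n≡m%n; %-distribˡ-+; %-distribˡ-*; [m+kn]%n≡m%n; m<n⇒m%n≡m; m%n<n)
  open import Data.Nat.Solver using (module +-*-Solver)
  open ≡ using (refl; cong; cong₂; sym; trans; subst)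
  open +-*-Solver

  private
    e : ℕ
    e = suc S

  infix 4 _≡ₘ_
  record _≡ₘ_ (a b : ℕ) : Set where
    constructor mod-≡
    field %-≡ : a % e ≡ b % e

  ≡ₘ-refl : ∀ {a} → a ≡ₘ a
  ≡ₘ-refl = mod-≡ refl

  ≡ₘ-trans : ∀ {a b c} → a ≡ₘ b → b ≡ₘ c → a ≡ₘ c
  ≡ₘ-trans (mod-≡ a≡b) (mod-≡ b≡c) = mod-≡ (trans a≡b b≡c)

  ≡ₘ-setoid : Setoid _ _
  ≡ₘ-setoid = record
    { Carrier = ℕ ; _≈_ = _≡ₘ_
    ; isEquivalence = record
      { refl = ≡ₘ-refl ; sym = λ (mod-≡ a≡b) → mod-≡ (sym a≡b) ; trans = ≡ₘ-trans } }

  ≡⇒≡ₘ : ∀ {a b} → a ≡ b → a ≡ₘ b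
  ≡⇒≡ₘ a≡b = mod-≡ (cong (_% e) a≡b)

  +-congₘ : ∀ {a a′ b b′} → a ≡ₘ a′ → b ≡ₘ b′ → a + b ≡ₘ a′ + b′
  +-congₘ {a} {a′} {b} {b′} (mod-≡ a≡) (mod-≡ b≡) = mod-≡ (begin
    (a + b) % e                   ≡⟨ %-distribˡ-+ a b e ⟩
    (a % e + b % e) % e           ≡⟨ cong₂ (λ x y → (x + y) % e) a≡ b≡ ⟩
    (a′ % e + b′ % e) % e         ≡⟨ %-distribˡ-+ a′ b′ e ⟨
    (a′ + b′) % e                 ∎)
    where open ≡.≡-Reasoning

  *-congₘ : ∀ {a a′ b b′} → a ≡ₘ a′ → b ≡ₘ b′ → a * b ≡ₘ a′ * b′
  *-congₘ {a} {a′} {b} {b′} (mod-≡ a≡) (mod-≡ b≡) = mod-≡ (begin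
    (a * b) % e                   ≡⟨ %-distribˡ-* a b e ⟩
    (a % e * (b % e)) % e         ≡⟨ cong₂ (λ x y → (x * y) % e) a≡ b≡ ⟩
    (a′ % e * (b′ % e)) % e       ≡⟨ %-distribˡ-* a′ b′ e ⟨
    (a′ * b′) % e                 ∎)
    where open ≡.≡-Reasoning

  %-≡ₘ : ∀ a → a % e ≡ₘ a
  %-≡ₘ a = mod-≡ (m%n%n≡m%n a e)

  +-multipleₘ : ∀ a k → a + k * e ≡ₘ a
  +-multipleₘ a k = mod-≡ ([m+kn]%n≡m%n a k e)

  S*S≡ₘ1 : S * S ≡ₘ 1
  S*S≡ₘ1 = begin
    S * S             ≈⟨ +-multipleₘ (S * S) 1 ⟨
    S * S + 1 * e     ≡⟨ solve 1 (λ s → s :* s :+ con 1 :* (con 1 :+ s) := con 1 :+ s :* (con 1 :+ s)) refl S ⟩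
    1 + S * e         ≈⟨ +-multipleₘ 1 S ⟩
    1                 ∎
    where open import Relation.Binary.Reasoning.Setoid ≡ₘ-setoid

  unit-*ₘ : ∀ {u} → u ≡ₘ 1 → ∀ a → u * a ≡ₘ a
  unit-*ₘ u≡1 a = ≡ₘ-trans (*-congₘ u≡1 ≡ₘ-refl) (≡⇒≡ₘ (ℕ.*-identityˡ a))

  toℕ-mod : ∀ a → toℕ (a mod e) ≡ a % e
  toℕ-mod a = Fin.toℕ-fromℕ< (m%n<n a e)

  mod-≡ₘ : ∀ a → toℕ (a mod e) ≡ₘ a
  mod-≡ₘ a = ≡ₘ-trans (≡⇒≡ₘ (toℕ-mod a)) (%-≡ₘ a)

  toℕ-mod-≡ₘ : ∀ {a b} → a ≡ₘ b → b < e → toℕ (a mod e) ≡ b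
  toℕ-mod-≡ₘ {a} (mod-≡ a≡b) b<e = trans (toℕ-mod a) (trans a≡b (m<n⇒m%n≡m b<e))

  toℕ-mod≡1⇒≡ₘ1 : ∀ a → toℕ (a mod e) ≡ 1 → a ≡ₘ 1
  toℕ-mod≡1⇒≡ₘ1 a a≡1 = mod-≡ (trans a%e≡1 (sym (m<n⇒m%n≡m 1<e)))
    where
    a%e≡1 = trans (sym (toℕ-mod a)) a≡1
    1<e   = subst (_< e) a%e≡1 (m%n<n a e)

-- With d d′ ≡ 1 modulo e, for each i the maps s ↦ d s + i and u ↦ d′ u − d′ i are mutually
-- inverse, and i ↦ −d′ i is inverted by j ↦ −d j.
module AffineReindexing (S : ℕ) (d d′ : Fin (suc S)) (inverse : Modular._≡ₘ_ S (toℕ d ℕ.* toℕ d′) 1) where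
  open import Data.Nat using (_+_; _*_)
  open import Data.Nat.DivMod using (_mod_)
  open import Data.Nat.Solver using (module +-*-Solver)
  open ≡ using (refl; cong; sym; trans)
  open Modular S
  open +-*-Solver
  open import Relation.Binary.Reasoning.Setoid ≡ₘ-setoid

  private
    e D D′ : ℕ
    e  = suc S
    D  = toℕ d
    D′ = toℕ d′

  negMul : Fin e → Fin e → Fin e
  negMul a i = (S * (toℕ a * toℕ i)) mod e

  shift : Fin e → Fin e → Fin e
  shift i s = (D * toℕ s + toℕ i) mod e

  unshift : Fin e → Fin e → Fin e
  unshift i u = (D′ * toℕ u + toℕ (negMul d′ i)) mod e

  negMul-inverse : ∀ i → negMul d (negMul d′ i) ≡ i
  negMul-inverse i = Fin.toℕ-injective (toℕ-mod-≡ₘ (begin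
    S * (D * toℕ (negMul d′ i))
      ≈⟨ *-congₘ {S} ≡ₘ-refl (*-congₘ {D} ≡ₘ-refl (mod-≡ₘ (S * (D′ * I)))) ⟩
    S * (D * (S * (D′ * I)))
      ≡⟨ solve 4 (λ S d d′ i → S :* (d :* (S :* (d′ :* i))) := (S :* S) :* ((d :* d′) :* i)) refl S D D′ I ⟩
    (S * S) * ((D * D′) * I)
      ≈⟨ unit-*ₘ S*S≡ₘ1 ((D * D′) * I) ⟩
    (D * D′) * I
      ≈⟨ unit-*ₘ inverse I ⟩
    I ∎) (Fin.toℕ<n i))
    where I = toℕ i

  negMul-injective : ∀ {i j} → negMul d′ i ≡ negMul d′ j → i ≡ j
  negMul-injective {i} {j} eq = trans (sym (negMul-inverse i)) (trans (cong (negMul d) eq) (negMul-inverse j))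

  unshift-shift : ∀ i s → unshift i (shift i s) ≡ s
  unshift-shift i s = Fin.toℕ-injective (toℕ-mod-≡ₘ (begin
    D′ * toℕ (shift i s) + toℕ (negMul d′ i)
      ≈⟨ +-congₘ (*-congₘ {D′} ≡ₘ-refl (mod-≡ₘ (D * s′ + I))) (mod-≡ₘ (S * (D′ * I))) ⟩
    D′ * (D * s′ + I) + S * (D′ * I)
      ≡⟨ solve 5 (λ d d′ i s S → d′ :* (d :* s :+ i) :+ S :* (d′ :* i)
                                := (d :* d′) :* s :+ (d′ :* i) :* (con 1 :+ S)) refl D D′ I s′ S ⟩
    (D * D′) * s′ + (D′ * I) * e
      ≈⟨ +-multipleₘ ((D * D′) * s′) (D′ * I) ⟩
    (D * D′) * s′
      ≈⟨ unit-*ₘ inverse s′ ⟩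
    s′ ∎) (Fin.toℕ<n s))
    where I = toℕ i; s′ = toℕ s

  shift-unshift : ∀ i u → shift i (unshift i u) ≡ u
  shift-unshift i u = Fin.toℕ-injective (toℕ-mod-≡ₘ (begin
    D * toℕ (unshift i u) + I
      ≈⟨ +-congₘ (*-congₘ {D} ≡ₘ-refl unshift≡) ≡ₘ-refl ⟩
    D * (D′ * u′ + S * (D′ * I)) + I
      ≡⟨ solve 5 (λ d d′ i u S → d :* (d′ :* u :+ S :* (d′ :* i)) :+ i
                                := (d :* d′) :* (u :+ S :* i) :+ i) refl D D′ I u′ S ⟩
    (D * D′) * (u′ + S * I) + I
      ≈⟨ +-congₘ (unit-*ₘ inverse (u′ + S * I)) ≡ₘ-refl ⟩
    (u′ + S * I) + I
      ≡⟨ solve 3 (λ u i S → (u :+ S :* i) :+ i := u :+ i :* (con 1 :+ S)) refl u′ I S ⟩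
    u′ + I * e
      ≈⟨ +-multipleₘ u′ I ⟩
    u′ ∎) (Fin.toℕ<n u))
    where
    I = toℕ i
    u′ = toℕ u
    unshift≡ : toℕ (unshift i u) ≡ₘ D′ * u′ + S * (D′ * I)
    unshift≡ = ≡ₘ-trans (mod-≡ₘ _) (+-congₘ {D′ * u′} ≡ₘ-refl (mod-≡ₘ (S * (D′ * I))))

module Determinant {c ℓ : Level} (R : CommutativeRing c ℓ) where
  open CommutativeRing R hiding (zero)
  open import Algebra.Properties.Ring ring using (-‿distribʳ-*; -‿involutive; -‿+-comm; -0#≈0#)
  open import Algebra.Properties.Semiring.Sum semiring using (sum; sum-cong-≋; sum-remove; ∑-comm; ∑-permute; *-distribˡ-sum)
  open import Algebra.Properties.CommutativeSemigroup *-commutativeSemigroup using (x∙yz≈y∙xz)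
  open import Relation.Binary.Reasoning.Setoid setoid

  signed : ℕ → Carrier → Carrier
  signed zero          x = x
  signed (suc zero)    x = - x
  signed (suc (suc k)) x = signed k x

  minor : Mat Carrier (suc n) → Fin (suc n) → Mat Carrier n
  minor M j r s = M (suc r) (punchIn j s)

  det : Mat Carrier n → Carrier
  det {zero}  M = 1#
  det {suc n} M = sum λ j → signed (toℕ j) (M zero j * det (minor M j))

  expansionTerm : Mat Carrier (suc n) → Fin (suc n) → Carrier
  expansionTerm M j = signed (toℕ j) (M zero j * det (minor M j))

  sum-neg : (f : Fin n → Carrier) → sum (λ i → - f i) ≈ - sum f
  sum-neg {zero}  f = sym -0#≈0#
  sum-neg {suc n} f = trans (+-congˡ (sum-neg (f ∘ suc))) (-‿+-comm _ _)

  sum-reindex : (f : Fin n → Carrier) (π π⁻¹ : Fin n → Fin n) →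
                (∀ i → π (π⁻¹ i) ≡ i) → (∀ i → π⁻¹ (π i) ≡ i) → sum f ≈ sum (f ∘ π)
  sum-reindex f π π⁻¹ inverseʳ inverseˡ = ∑-permute f (permutation π π⁻¹ inverseʳ inverseˡ)

  signed-inject₁ : (k : Fin n) (x : Carrier) → signed (toℕ (inject₁ k)) x ≡ signed (toℕ k) x
  signed-inject₁ k x = ≡.cong (λ t → signed t x) (Fin.toℕ-inject₁ k)

  signed-cong : ∀ k {x y} → x ≈ y → signed k x ≈ signed k y
  signed-cong zero          x≈y = x≈y
  signed-cong (suc zero)    x≈y = -‿cong x≈y
  signed-cong (suc (suc k)) x≈y = signed-cong k x≈y

  signed-neg : ∀ k x → signed k (- x) ≈ - signed k x
  signed-neg zero          x = refl
  signed-neg (suc zero)    x = refl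
  signed-neg (suc (suc k)) x = signed-neg k x

  signed-suc : ∀ k x → signed (suc k) x ≈ - signed k x
  signed-suc zero          x = refl
  signed-suc (suc zero)    x = sym (-‿involutive x)
  signed-suc (suc (suc k)) x = signed-suc k x

  signed-+ : ∀ a b x → signed (a ℕ.+ b) x ≈ signed a (signed b x)
  signed-+ zero          b x = refl
  signed-+ (suc zero)    b x = signed-suc b x
  signed-+ (suc (suc a)) b x = signed-+ a b x

  signed-*ˡ : ∀ k a x → signed k (a * x) ≈ a * signed k x
  signed-*ˡ zero          a x = refl
  signed-*ˡ (suc zero)    a x = -‿distribʳ-* a x
  signed-*ˡ (suc (suc k)) a x = signed-*ˡ k a x

  signed-sum : ∀ k (f : Fin n → Carrier) → signed k (sum f) ≈ sum (λ i → signed k (f i))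
  signed-sum {zero}  k f = signed-0# k
    where
    signed-0# : ∀ k → signed k 0# ≈ 0#
    signed-0# zero          = refl
    signed-0# (suc zero)    = -0#≈0#
    signed-0# (suc (suc k)) = signed-0# k
  signed-sum {suc n} k f = trans (signed-distrib-+ k _ _) (+-congˡ (signed-sum k (f ∘ suc)))
    where
    signed-distrib-+ : ∀ k x y → signed k (x + y) ≈ signed k x + signed k y
    signed-distrib-+ zero          x y = refl
    signed-distrib-+ (suc zero)    x y = sym (-‿+-comm x y)
    signed-distrib-+ (suc (suc k)) x y = signed-distrib-+ k x y

  signed-pairParity : (j : Fin (suc (suc n))) (l : Fin (suc n)) (x : Carrier) →
                      signed (toℕ j ℕ.+ toℕ l) x ≈ signed (pairParity j (punchIn j l)) x
  signed-pairParity zero    l       x = refl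
  signed-pairParity (suc j) zero    x = reflexive (≡.cong (λ k → signed (suc k) x) (ℕ.+-identityʳ (toℕ j)))
  signed-pairParity {suc n} (suc j) (suc l) x =
    trans (reflexive (≡.cong (λ k → signed (suc k) x) (ℕ.+-suc (toℕ j) (toℕ l)))) (signed-pairParity j l x)

  signed-pairParity-comm : (j j′ : Fin n) → j ≢ j′ → ∀ x → signed (pairParity j′ j) x ≈ - signed (pairParity j j′) x
  signed-pairParity-comm zero    zero     j≢j′ x = ⊥-elim (j≢j′ ≡.refl)
  signed-pairParity-comm zero    (suc j′) j≢j′ x = signed-suc (toℕ j′) x
  signed-pairParity-comm (suc j) zero     j≢j′ x = trans (sym (-‿involutive _)) (-‿cong (sym (signed-suc (toℕ j) x)))
  signed-pairParity-comm (suc j) (suc j′) j≢j′ x = signed-pairParity-comm j j′ (j≢j′ ∘ ≡.cong suc) x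

  det-cong : ∀ {M N : Mat Carrier n} → (∀ i j → M i j ≈ N i j) → det M ≈ det N
  det-cong {zero}  M≈N = refl
  det-cong {suc n} M≈N = sum-cong-≋ λ j →
    signed-cong (toℕ j) (*-cong (M≈N zero j) (det-cong λ r s → M≈N (suc r) (punchIn j s)))

  det-cong-≡ : ∀ {M N : Mat Carrier n} → (∀ i j → M i j ≡ N i j) → det M ≈ det N
  det-cong-≡ M≡N = det-cong λ i j → reflexive (M≡N i j)

  det-swapColumns : (k : Fin n) (M : Mat Carrier (suc n)) → det (λ i j → M i (adjSwap k j)) ≈ - det M

  expansionTerm-swapColumns : (k : Fin (suc n)) (M : Mat Carrier (suc (suc n))) (l : Fin (suc (suc n))) →
                              expansionTerm (λ i j → M i (adjSwap k j)) (adjSwap k l) ≈ - expansionTerm M l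
  expansionTerm-swapColumns k M l with adjSwapView k l
  ... | at-inject₁ = begin
    expansionTerm M′ (adjSwap k (inject₁ k))
      ≡⟨ ≡.cong (expansionTerm M′) (adjSwap-inject₁ k) ⟩
    signed (suc (toℕ k)) (M′ zero (suc k) * det (minor M′ (suc k)))
      ≈⟨ signed-cong (suc (toℕ k)) (*-cong (reflexive (≡.cong (M zero) (adjSwap-suc k)))
                                            (det-cong-≡ λ r s → ≡.cong (M (suc r)) (adjSwap-punchIn-suc k s))) ⟩
    signed (suc (toℕ k)) (M zero (inject₁ k) * det (minor M (inject₁ k)))
      ≈⟨ signed-suc (toℕ k) _ ⟩
    - signed (toℕ k) (M zero (inject₁ k) * det (minor M (inject₁ k)))
      ≡⟨ ≡.cong -_ (signed-inject₁ k _) ⟨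
    - expansionTerm M (inject₁ k) ∎
    where M′ = λ i j → M i (adjSwap k j)
  ... | at-suc = begin
    expansionTerm M′ (adjSwap k (suc k))
      ≡⟨ ≡.cong (expansionTerm M′) (adjSwap-suc k) ⟩
    signed (toℕ (inject₁ k)) (M′ zero (inject₁ k) * det (minor M′ (inject₁ k)))
      ≡⟨ signed-inject₁ k _ ⟩
    signed (toℕ k) (M′ zero (inject₁ k) * det (minor M′ (inject₁ k)))
      ≈⟨ signed-cong (toℕ k) (*-cong (reflexive (≡.cong (M zero) (adjSwap-inject₁ k)))
                                      (det-cong-≡ λ r s → ≡.cong (M (suc r)) (adjSwap-punchIn-inject₁ k s))) ⟩
    signed (toℕ k) (M zero (suc k) * det (minor M (suc k)))
      ≈⟨ sym (-‿involutive _) ⟩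
    - - signed (toℕ k) (M zero (suc k) * det (minor M (suc k)))
      ≈⟨ -‿cong (signed-suc (toℕ k) _) ⟨
    - expansionTerm M (suc k) ∎
    where M′ = λ i j → M i (adjSwap k j)
  ... | elsewhere k′ fixed commute = begin
    expansionTerm M′ (adjSwap k l)
      ≡⟨ ≡.cong (expansionTerm M′) fixed ⟩
    signed (toℕ l) (M′ zero l * det (minor M′ l))
      ≈⟨ signed-cong (toℕ l) (*-cong (reflexive (≡.cong (M zero) fixed))
                                      (det-cong-≡ λ r s → ≡.cong (M (suc r)) (commute s))) ⟩
    signed (toℕ l) (M zero l * det (λ r s → minor M l r (adjSwap k′ s)))
      ≈⟨ signed-cong (toℕ l) (*-congˡ (det-swapColumns k′ (minor M l))) ⟩
    signed (toℕ l) (M zero l * - det (minor M l))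
      ≈⟨ signed-cong (toℕ l) (sym (-‿distribʳ-* _ _)) ⟩
    signed (toℕ l) (- (M zero l * det (minor M l)))
      ≈⟨ signed-neg (toℕ l) _ ⟩
    - expansionTerm M l ∎
    where M′ = λ i j → M i (adjSwap k j)

  det-swapColumns {suc n} k M = begin
    sum (expansionTerm M′)                 ≈⟨ sum-reindex (expansionTerm M′) (adjSwap k) (adjSwap k)
                                                          (adjSwap-involutive k) (adjSwap-involutive k) ⟩
    sum (expansionTerm M′ ∘ adjSwap k)     ≈⟨ sum-cong-≋ (expansionTerm-swapColumns k M) ⟩
    sum (λ l → - expansionTerm M l)        ≈⟨ sum-neg (expansionTerm M) ⟩
    - sum (expansionTerm M)                ∎
    where M′ = λ i j → M i (adjSwap k j)

  twoRowTermᵈ : (M : Mat Carrier (suc (suc n))) (j j′ : Fin (suc (suc n))) → Dec (j ≡ j′) → Carrier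
  twoRowTermᵈ M j j′ (yes _) = 0#
  twoRowTermᵈ M j j′ (no _)  =
    signed (pairParity j j′) (M zero j * (M (suc zero) j′ * det (λ r c → M (suc (suc r)) (removeTwo j j′ c))))

  twoRowTerm : Mat Carrier (suc (suc n)) → Fin (suc (suc n)) → Fin (suc (suc n)) → Carrier
  twoRowTerm M j j′ = twoRowTermᵈ M j j′ (j ≟ j′)

  twoRowTerm-diag : (M : Mat Carrier (suc (suc n))) (j : Fin (suc (suc n))) → twoRowTerm M j j ≈ 0#
  twoRowTerm-diag M j with j ≟ j
  ... | yes _   = refl
  ... | no j≢j  = ⊥-elim (j≢j ≡.refl)

  twoRowTerm-≢ : (M : Mat Carrier (suc (suc n))) {j j′ : Fin (suc (suc n))} (j≢j′ : j ≢ j′) →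
                 twoRowTerm M j j′ ≈ twoRowTermᵈ M j j′ (no j≢j′)
  twoRowTerm-≢ M {j} {j′} j≢j′ with j ≟ j′
  ... | yes j≡j′ = ⊥-elim (j≢j′ j≡j′)
  ... | no _     = refl

  det-expand-twoRows : (M : Mat Carrier (suc (suc n))) → det M ≈ sum (λ j → sum (twoRowTerm M j))
  det-expand-twoRows {n} M = sum-cong-≋ row
    where
    term : ∀ j l → signed (toℕ j) (M zero j * expansionTerm (minor M j) l) ≈ twoRowTerm M j (punchIn j l)
    term j l = begin
      signed (toℕ j) (M zero j * signed (toℕ l) (M (suc zero) (punchIn j l) * det (minor (minor M j) l)))
        ≈⟨ signed-cong (toℕ j) (sym (signed-*ˡ (toℕ l) _ _)) ⟩
      signed (toℕ j) (signed (toℕ l) (M zero j * (M (suc zero) (punchIn j l) * det (minor (minor M j) l))))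
        ≈⟨ signed-+ (toℕ j) (toℕ l) _ ⟨
      signed (toℕ j ℕ.+ toℕ l) (M zero j * (M (suc zero) (punchIn j l) * det (minor (minor M j) l)))
        ≈⟨ signed-pairParity j l _ ⟩
      signed (pairParity j (punchIn j l)) (M zero j * (M (suc zero) (punchIn j l) * det (minor (minor M j) l)))
        ≈⟨ signed-cong (pairParity j (punchIn j l))
             (*-congˡ (*-congˡ (det-cong-≡ λ r c → ≡.cong (M (suc (suc r))) (punchIn-punchIn j l c)))) ⟩
      twoRowTermᵈ M j (punchIn j l) (no (Fin.punchInᵢ≢i j l ∘ ≡.sym))
        ≈⟨ twoRowTerm-≢ M (Fin.punchInᵢ≢i j l ∘ ≡.sym) ⟨
      twoRowTerm M j (punchIn j l) ∎
    row : ∀ j → expansionTerm M j ≈ sum (twoRowTerm M j)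
    row j = begin
      signed (toℕ j) (M zero j * det (minor M j))
        ≈⟨ signed-cong (toℕ j) (*-distribˡ-sum (M zero j) (expansionTerm (minor M j))) ⟩
      signed (toℕ j) (sum (λ l → M zero j * expansionTerm (minor M j) l))
        ≈⟨ signed-sum (toℕ j) (λ l → M zero j * expansionTerm (minor M j) l) ⟩
      sum (λ l → signed (toℕ j) (M zero j * expansionTerm (minor M j) l))
        ≈⟨ sum-cong-≋ (term j) ⟩
      sum (λ l → twoRowTerm M j (punchIn j l))
        ≈⟨ +-identityˡ _ ⟨
      0# + sum (λ l → twoRowTerm M j (punchIn j l))
        ≈⟨ +-congʳ (twoRowTerm-diag M j) ⟨
      twoRowTerm M j j + sum (λ l → twoRowTerm M j (punchIn j l))
        ≈⟨ sum-remove (twoRowTerm M j) ⟨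
      sum (twoRowTerm M j) ∎

  det-swapFirstRows : (M : Mat Carrier (suc (suc n))) → det (M ∘ adjSwap zero) ≈ - det M
  det-swapFirstRows {n} M = begin
    det M′                                              ≈⟨ det-expand-twoRows M′ ⟩
    sum (λ j → sum (λ j′ → twoRowTerm M′ j j′))         ≈⟨ sum-cong-≋ (λ j → sum-cong-≋ (antisymmetric j)) ⟩
    sum (λ j → sum (λ j′ → - twoRowTerm M j′ j))        ≈⟨ sum-cong-≋ (λ j → sum-neg (λ j′ → twoRowTerm M j′ j)) ⟩
    sum (λ j → - sum (λ j′ → twoRowTerm M j′ j))        ≈⟨ sum-neg (λ j → sum (λ j′ → twoRowTerm M j′ j)) ⟩
    - sum (λ j → sum (λ j′ → twoRowTerm M j′ j))        ≈⟨ -‿cong (∑-comm (λ j j′ → twoRowTerm M j′ j)) ⟩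
    - sum (λ j′ → sum (λ j → twoRowTerm M j′ j))        ≈⟨ -‿cong (det-expand-twoRows M) ⟨
    - det M                                             ∎
    where
    M′ : Mat Carrier (suc (suc n))
    M′ = M ∘ adjSwap zero
    antisymmetric : ∀ j j′ → twoRowTerm M′ j j′ ≈ - twoRowTerm M j′ j
    antisymmetric j j′ with j ≟ j′ | j′ ≟ j
    ... | yes _    | yes _    = sym -0#≈0#
    ... | yes j≡j′ | no j′≢j  = ⊥-elim (j′≢j (≡.sym j≡j′))
    ... | no j≢j′  | yes j′≡j = ⊥-elim (j≢j′ (≡.sym j′≡j))
    ... | no j≢j′  | no _     = begin
      signed (pairParity j j′) (M (suc zero) j * (M zero j′ * det (λ r c → M (suc (suc r)) (removeTwo j j′ c))))
        ≈⟨ signed-cong (pairParity j j′) (trans (x∙yz≈y∙xz _ _ _)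
             (*-congˡ (*-congˡ (det-cong-≡ λ r c → ≡.cong (M (suc (suc r))) (removeTwo-comm j j′ c))))) ⟩
      signed (pairParity j j′) (M zero j′ * (M (suc zero) j * det (λ r c → M (suc (suc r)) (removeTwo j′ j c))))
        ≈⟨ signed-pairParity-comm j′ j (j≢j′ ∘ ≡.sym) _ ⟩
      - signed (pairParity j′ j) (M zero j′ * (M (suc zero) j * det (λ r c → M (suc (suc r)) (removeTwo j′ j c)))) ∎

  det-swapRows : (k : Fin n) (M : Mat Carrier (suc n)) → det (M ∘ adjSwap k) ≈ - det M
  det-swapRows {suc n} zero    M = det-swapFirstRows M
  det-swapRows {suc n} (suc k) M = begin
    sum (λ j → signed (toℕ j) (M zero j * det (minor M j ∘ adjSwap k)))
      ≈⟨ sum-cong-≋ (λ j → signed-cong (toℕ j) (*-congˡ {M zero j} (det-swapRows k (minor M j)))) ⟩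
    sum (λ j → signed (toℕ j) (M zero j * - det (minor M j)))
      ≈⟨ sum-cong-≋ (λ j → trans (signed-cong (toℕ j) (sym (-‿distribʳ-* (M zero j) (det (minor M j)))))
                                  (signed-neg (toℕ j) _)) ⟩
    sum (λ j → - expansionTerm M j)
      ≈⟨ sum-neg (expansionTerm M) ⟩
    - det M ∎

  det-conj-adjSwap : (k : Fin n) (M : Mat Carrier (suc n)) → det (λ i j → M (adjSwap k i) (adjSwap k j)) ≈ det M
  det-conj-adjSwap k M = begin
    det (λ i j → M (adjSwap k i) (adjSwap k j)) ≈⟨ det-swapColumns k (M ∘ adjSwap k) ⟩
    - det (M ∘ adjSwap k)                       ≈⟨ -‿cong (det-swapRows k M) ⟩
    - - det M                                   ≈⟨ -‿involutive (det M) ⟩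
    det M                                       ∎

  det-conj-injective : (σ : Fin (suc n) → Fin (suc n)) → Injective _≡_ _≡_ σ →
                       (M : Mat Carrier (suc n)) → det (λ i j → M (σ i) (σ j)) ≈ det M
  det-conj-injective = SwapInduction.swap-induction InvariantDet resp (λ _ → refl) step
    where
    InvariantDet : (Fin (suc n) → Fin (suc n)) → Set (c ⊔ ℓ)
    InvariantDet σ = ∀ M → det (λ i j → M (σ i) (σ j)) ≈ det M
    resp : ∀ {σ τ} → (∀ i → σ i ≡ τ i) → InvariantDet σ → InvariantDet τ
    resp σ≗τ inv M = trans (det-cong-≡ λ i j → ≡.cong₂ M (≡.sym (σ≗τ i)) (≡.sym (σ≗τ j))) (inv M)
    step : ∀ k {σ} → InvariantDet σ → InvariantDet (adjSwap k ∘ σ)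
    step k {σ} inv M = trans (inv (λ a b → M (adjSwap k a) (adjSwap k b))) (det-conj-adjSwap k M)

module Polynomial {c ℓ : Level} (K : CommutativeRing c ℓ) where
  open CommutativeRing K hiding (zero)
  open import Algebra.Properties.Ring ring using (-0#≈0#)
  open MatrixOps K using (Poly; _+ₚ_; -ₚ_; _·ₚ_; _*ₚ_; 0ₚ; 1ₚ; IsZeroₚ; _≈ₚ_)

  coeff : Poly → ℕ → Carrier
  coeff []      n       = 0#
  coeff (a ∷ p) zero    = a
  coeff (a ∷ p) (suc n) = coeff p n

  -- Unlike _≈ₚ_, this relation is a record, so both polynomials can be inferred from it.
  infix 4 _≃_
  record _≃_ (p q : Poly) : Set ℓ where
    constructor coeffs-≈
    field coeff-≈ : ∀ n → coeff p n ≈ coeff q n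
  open _≃_

  ≃-isEquivalence : IsEquivalence _≃_
  ≃-isEquivalence = record
    { refl  = coeffs-≈ λ _ → refl
    ; sym   = λ p≃q → coeffs-≈ λ n → sym (coeff-≈ p≃q n)
    ; trans = λ p≃q q≃r → coeffs-≈ λ n → trans (coeff-≈ p≃q n) (coeff-≈ q≃r n) }

  ≃-setoid : Setoid c ℓ
  ≃-setoid = record { isEquivalence = ≃-isEquivalence }

  open IsEquivalence ≃-isEquivalence public
    using () renaming (refl to ≃-refl; sym to ≃-sym; trans to ≃-trans; reflexive to ≡⇒≃)

  coeff-+ₚ : ∀ p q n → coeff (p +ₚ q) n ≈ coeff p n + coeff q n
  coeff-+ₚ []      q       n       = sym (+-identityˡ _)
  coeff-+ₚ (a ∷ p) []      n       = sym (+-identityʳ _)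
  coeff-+ₚ (a ∷ p) (b ∷ q) zero    = refl
  coeff-+ₚ (a ∷ p) (b ∷ q) (suc n) = coeff-+ₚ p q n

  coeff--ₚ : ∀ p n → coeff (-ₚ p) n ≈ - coeff p n
  coeff--ₚ []      n       = sym -0#≈0#
  coeff--ₚ (a ∷ p) zero    = refl
  coeff--ₚ (a ∷ p) (suc n) = coeff--ₚ p n

  coeff-·ₚ : ∀ a p n → coeff (a ·ₚ p) n ≈ a * coeff p n
  coeff-·ₚ a []      n       = sym (zeroʳ a)
  coeff-·ₚ a (b ∷ p) zero    = refl
  coeff-·ₚ a (b ∷ p) (suc n) = coeff-·ₚ a p n

  ∷-cong : ∀ {a b p q} → a ≈ b → p ≃ q → a ∷ p ≃ b ∷ q
  ∷-cong a≈b p≃q = coeffs-≈ λ { zero → a≈b ; (suc n) → coeff-≈ p≃q n }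

  +ₚ-cong : ∀ {p p′ q q′} → p ≃ p′ → q ≃ q′ → p +ₚ q ≃ p′ +ₚ q′
  +ₚ-cong {p} {p′} {q} {q′} p≃p′ q≃q′ = coeffs-≈ λ n →
    trans (coeff-+ₚ p q n) (trans (+-cong (coeff-≈ p≃p′ n) (coeff-≈ q≃q′ n)) (sym (coeff-+ₚ p′ q′ n)))

  +ₚ-assoc : ∀ p q r → (p +ₚ q) +ₚ r ≃ p +ₚ (q +ₚ r)
  +ₚ-assoc p q r = coeffs-≈ λ n → begin
    coeff ((p +ₚ q) +ₚ r) n                ≈⟨ trans (coeff-+ₚ (p +ₚ q) r n) (+-congʳ (coeff-+ₚ p q n)) ⟩
    (coeff p n + coeff q n) + coeff r n    ≈⟨ +-assoc _ _ _ ⟩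
    coeff p n + (coeff q n + coeff r n)    ≈⟨ trans (coeff-+ₚ p (q +ₚ r) n) (+-congˡ (coeff-+ₚ q r n)) ⟨
    coeff (p +ₚ (q +ₚ r)) n                ∎
    where open import Relation.Binary.Reasoning.Setoid setoid

  +ₚ-comm : ∀ p q → p +ₚ q ≃ q +ₚ p
  +ₚ-comm p q = coeffs-≈ λ n → trans (coeff-+ₚ p q n) (trans (+-comm _ _) (sym (coeff-+ₚ q p n)))

  +ₚ-identityʳ : ∀ p → p +ₚ [] ≃ p
  +ₚ-identityʳ p = coeffs-≈ λ n → trans (coeff-+ₚ p [] n) (+-identityʳ _)

  -ₚ-cong : ∀ {p q} → p ≃ q → -ₚ p ≃ -ₚ q
  -ₚ-cong {p} {q} p≃q = coeffs-≈ λ n → trans (coeff--ₚ p n) (trans (-‿cong (coeff-≈ p≃q n)) (sym (coeff--ₚ q n)))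

  -ₚ-inverseˡ : ∀ p → (-ₚ p) +ₚ p ≃ []
  -ₚ-inverseˡ p = coeffs-≈ λ n → trans (coeff-+ₚ (-ₚ p) p n) (trans (+-congʳ (coeff--ₚ p n)) (-‿inverseˡ _))

  ·ₚ-cong : ∀ {a b p q} → a ≈ b → p ≃ q → a ·ₚ p ≃ b ·ₚ q
  ·ₚ-cong {a} {b} {p} {q} a≈b p≃q = coeffs-≈ λ n →
    trans (coeff-·ₚ a p n) (trans (*-cong a≈b (coeff-≈ p≃q n)) (sym (coeff-·ₚ b q n)))

  ·ₚ-distribˡ : ∀ a p q → a ·ₚ (p +ₚ q) ≃ a ·ₚ p +ₚ a ·ₚ q
  ·ₚ-distribˡ a p q = coeffs-≈ λ n →
    trans (coeff-·ₚ a (p +ₚ q) n) (trans (*-congˡ (coeff-+ₚ p q n)) (trans (distribˡ _ _ _)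
      (sym (trans (coeff-+ₚ (a ·ₚ p) (a ·ₚ q) n) (+-cong (coeff-·ₚ a p n) (coeff-·ₚ a q n))))))

  ·ₚ-distribʳ : ∀ a b p → (a + b) ·ₚ p ≃ a ·ₚ p +ₚ b ·ₚ p
  ·ₚ-distribʳ a b p = coeffs-≈ λ n →
    trans (coeff-·ₚ (a + b) p n) (trans (distribʳ _ _ _)
      (sym (trans (coeff-+ₚ (a ·ₚ p) (b ·ₚ p) n) (+-cong (coeff-·ₚ a p n) (coeff-·ₚ b p n)))))

  ·ₚ-assoc : ∀ a b p → a ·ₚ (b ·ₚ p) ≃ (a * b) ·ₚ p
  ·ₚ-assoc a b p = coeffs-≈ λ n →
    trans (coeff-·ₚ a (b ·ₚ p) n)
      (trans (*-congˡ (coeff-·ₚ b p n)) (trans (sym (*-assoc _ _ _)) (sym (coeff-·ₚ (a * b) p n))))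

  ·ₚ-zeroˡ : ∀ p → 0# ·ₚ p ≃ []
  ·ₚ-zeroˡ p = coeffs-≈ λ n → trans (coeff-·ₚ 0# p n) (zeroˡ _)

  ·ₚ-identityˡ : ∀ p → 1# ·ₚ p ≃ p
  ·ₚ-identityˡ p = coeffs-≈ λ n → trans (coeff-·ₚ 1# p n) (*-identityˡ _)

  +ₚ-commutativeMonoid : CommutativeMonoid c ℓ
  +ₚ-commutativeMonoid = record
    { _≈_ = _≃_ ; _∙_ = _+ₚ_ ; ε = []
    ; isCommutativeMonoid = record
      { isMonoid = record
        { isSemigroup = record { isMagma = record { isEquivalence = ≃-isEquivalence ; ∙-cong = +ₚ-cong } ; assoc = +ₚ-assoc }
        ; identity = (λ _ → ≃-refl) , +ₚ-identityʳ }
      ; comm = +ₚ-comm } }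

  open import Algebra.Properties.CommutativeSemigroup (CommutativeMonoid.commutativeSemigroup +ₚ-commutativeMonoid)
    using (interchange; x∙yz≈y∙xz)
  open import Relation.Binary.Reasoning.Setoid ≃-setoid

  0∷-+ₚ : ∀ p q → (0# ∷ p) +ₚ (0# ∷ q) ≃ 0# ∷ (p +ₚ q)
  0∷-+ₚ p q = ∷-cong (+-identityʳ 0#) ≃-refl

  0∷-≃-[] : ∀ {p} → p ≃ [] → 0# ∷ p ≃ []
  0∷-≃-[] p≃[] = coeffs-≈ λ { zero → refl ; (suc n) → coeff-≈ p≃[] n }

  *ₚ-congˡ : ∀ p {q q′} → q ≃ q′ → p *ₚ q ≃ p *ₚ q′
  *ₚ-congˡ []      q≃q′ = ≃-refl
  *ₚ-congˡ (a ∷ p) q≃q′ = +ₚ-cong (·ₚ-cong refl q≃q′) (∷-cong refl (*ₚ-congˡ p q≃q′))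

  *ₚ-zeroʳ : ∀ p → p *ₚ [] ≃ []
  *ₚ-zeroʳ []      = ≃-refl
  *ₚ-zeroʳ (a ∷ p) = 0∷-≃-[] (*ₚ-zeroʳ p)

  *ₚ-∷ʳ : ∀ p b q → p *ₚ (b ∷ q) ≃ b ·ₚ p +ₚ (0# ∷ (p *ₚ q))
  *ₚ-∷ʳ []      b q = ≃-sym (0∷-≃-[] ≃-refl)
  *ₚ-∷ʳ (a ∷ p) b q = ∷-cong (+-congʳ (*-comm a b)) (begin
    a ·ₚ q +ₚ p *ₚ (b ∷ q)                    ≈⟨ +ₚ-cong ≃-refl (*ₚ-∷ʳ p b q) ⟩
    a ·ₚ q +ₚ (b ·ₚ p +ₚ (0# ∷ (p *ₚ q)))     ≈⟨ x∙yz≈y∙xz (a ·ₚ q) (b ·ₚ p) _ ⟩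
    b ·ₚ p +ₚ (a ·ₚ q +ₚ (0# ∷ (p *ₚ q)))     ∎)

  *ₚ-comm : ∀ p q → p *ₚ q ≃ q *ₚ p
  *ₚ-comm []      q = ≃-sym (*ₚ-zeroʳ q)
  *ₚ-comm (a ∷ p) q = begin
    a ·ₚ q +ₚ (0# ∷ (p *ₚ q))   ≈⟨ +ₚ-cong ≃-refl (∷-cong refl (*ₚ-comm p q)) ⟩
    a ·ₚ q +ₚ (0# ∷ (q *ₚ p))   ≈⟨ *ₚ-∷ʳ q a p ⟨
    q *ₚ (a ∷ p)                ∎

  *ₚ-cong : ∀ {p p′ q q′} → p ≃ p′ → q ≃ q′ → p *ₚ q ≃ p′ *ₚ q′
  *ₚ-cong {p} {p′} {q} {q′} p≃p′ q≃q′ = begin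
    p *ₚ q    ≈⟨ *ₚ-congˡ p q≃q′ ⟩
    p *ₚ q′   ≈⟨ *ₚ-comm p q′ ⟩
    q′ *ₚ p   ≈⟨ *ₚ-congˡ q′ p≃p′ ⟩
    q′ *ₚ p′  ≈⟨ *ₚ-comm q′ p′ ⟩
    p′ *ₚ q′  ∎

  *ₚ-distribʳ : ∀ r p q → (p +ₚ q) *ₚ r ≃ p *ₚ r +ₚ q *ₚ r
  *ₚ-distribʳ r []      q       = ≃-refl
  *ₚ-distribʳ r (a ∷ p) []      = ≃-sym (+ₚ-identityʳ _)
  *ₚ-distribʳ r (a ∷ p) (b ∷ q) = begin
    (a + b) ·ₚ r +ₚ (0# ∷ ((p +ₚ q) *ₚ r))
      ≈⟨ +ₚ-cong (·ₚ-distribʳ a b r) (∷-cong refl (*ₚ-distribʳ r p q)) ⟩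
    (a ·ₚ r +ₚ b ·ₚ r) +ₚ (0# ∷ (p *ₚ r +ₚ q *ₚ r))
      ≈⟨ +ₚ-cong ≃-refl (0∷-+ₚ (p *ₚ r) (q *ₚ r)) ⟨
    (a ·ₚ r +ₚ b ·ₚ r) +ₚ ((0# ∷ (p *ₚ r)) +ₚ (0# ∷ (q *ₚ r)))
      ≈⟨ interchange (a ·ₚ r) (b ·ₚ r) _ _ ⟩
    (a ·ₚ r +ₚ (0# ∷ (p *ₚ r))) +ₚ (b ·ₚ r +ₚ (0# ∷ (q *ₚ r))) ∎

  *ₚ-distribˡ : ∀ p q r → p *ₚ (q +ₚ r) ≃ p *ₚ q +ₚ p *ₚ r
  *ₚ-distribˡ p q r = begin
    p *ₚ (q +ₚ r)          ≈⟨ *ₚ-comm p (q +ₚ r) ⟩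
    (q +ₚ r) *ₚ p          ≈⟨ *ₚ-distribʳ p q r ⟩
    q *ₚ p +ₚ r *ₚ p       ≈⟨ +ₚ-cong (*ₚ-comm q p) (*ₚ-comm r p) ⟩
    p *ₚ q +ₚ p *ₚ r       ∎

  ·ₚ-*ₚ : ∀ a q r → (a ·ₚ q) *ₚ r ≃ a ·ₚ (q *ₚ r)
  ·ₚ-*ₚ a []      r = ≃-refl
  ·ₚ-*ₚ a (b ∷ q) r = begin
    (a * b) ·ₚ r +ₚ (0# ∷ ((a ·ₚ q) *ₚ r))     ≈⟨ +ₚ-cong (≃-sym (·ₚ-assoc a b r)) (∷-cong (sym (zeroʳ a)) (·ₚ-*ₚ a q r)) ⟩
    a ·ₚ (b ·ₚ r) +ₚ a ·ₚ (0# ∷ (q *ₚ r))      ≈⟨ ·ₚ-distribˡ a (b ·ₚ r) _ ⟨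
    a ·ₚ (b ·ₚ r +ₚ (0# ∷ (q *ₚ r)))           ∎

  *ₚ-assoc : ∀ p q r → (p *ₚ q) *ₚ r ≃ p *ₚ (q *ₚ r)
  *ₚ-assoc []      q r = ≃-refl
  *ₚ-assoc (a ∷ p) q r = begin
    (a ·ₚ q +ₚ (0# ∷ (p *ₚ q))) *ₚ r             ≈⟨ *ₚ-distribʳ r (a ·ₚ q) _ ⟩
    (a ·ₚ q) *ₚ r +ₚ (0# ∷ (p *ₚ q)) *ₚ r        ≈⟨ +ₚ-cong (·ₚ-*ₚ a q r) (+ₚ-cong (·ₚ-zeroˡ r) ≃-refl) ⟩
    a ·ₚ (q *ₚ r) +ₚ (0# ∷ ((p *ₚ q) *ₚ r))      ≈⟨ +ₚ-cong ≃-refl (∷-cong refl (*ₚ-assoc p q r)) ⟩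
    a ·ₚ (q *ₚ r) +ₚ (0# ∷ (p *ₚ (q *ₚ r)))      ∎

  *ₚ-identityˡ : ∀ p → 1ₚ *ₚ p ≃ p
  *ₚ-identityˡ p = ≃-trans (+ₚ-cong (·ₚ-identityˡ p) (0∷-≃-[] ≃-refl)) (+ₚ-identityʳ p)

  polyRing : CommutativeRing c ℓ
  polyRing = record
    { Carrier = Poly ; _≈_ = _≃_ ; _+_ = _+ₚ_ ; _*_ = _*ₚ_ ; -_ = -ₚ_ ; 0# = 0ₚ ; 1# = 1ₚ
    ; isCommutativeRing = record
      { isRing = record
        { +-isAbelianGroup = record
          { isGroup = record
            { isMonoid = CommutativeMonoid.isMonoid +ₚ-commutativeMonoid
            ; inverse  = -ₚ-inverseˡ , (λ p → ≃-trans (+ₚ-comm p (-ₚ p)) (-ₚ-inverseˡ p))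
            ; ⁻¹-cong  = -ₚ-cong }
          ; comm = +ₚ-comm }
        ; *-cong     = *ₚ-cong
        ; *-assoc    = *ₚ-assoc
        ; *-identity = *ₚ-identityˡ , (λ p → ≃-trans (*ₚ-comm p 1ₚ) (*ₚ-identityˡ p))
        ; distrib    = *ₚ-distribˡ , *ₚ-distribʳ }
      ; *-comm = *ₚ-comm } }

  coeffs-≈0⇒IsZeroₚ : ∀ p → (∀ n → coeff p n ≈ 0#) → IsZeroₚ p
  coeffs-≈0⇒IsZeroₚ []      _     = _
  coeffs-≈0⇒IsZeroₚ (a ∷ p) zeros = zeros zero , coeffs-≈0⇒IsZeroₚ p λ n → zeros (suc n)

  ≃⇒≈ₚ : ∀ {p q} → p ≃ q → p ≈ₚ q
  ≃⇒≈ₚ {[]}    {q}     p≃q = coeffs-≈0⇒IsZeroₚ q λ n → sym (coeff-≈ p≃q n)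
  ≃⇒≈ₚ {a ∷ p} {[]}    p≃q = coeffs-≈0⇒IsZeroₚ (a ∷ p) (coeff-≈ p≃q)
  ≃⇒≈ₚ {a ∷ p} {b ∷ q} p≃q = coeff-≈ p≃q zero , ≃⇒≈ₚ {p} {q} (coeffs-≈ λ n → coeff-≈ p≃q (suc n))

module CharacteristicPolynomial {c ℓ : Level} (K : CommutativeRing c ℓ) where
  open CommutativeRing K using (Carrier; _≈_; -‿cong)
  open MatrixOps K
  open Polynomial K
  open Determinant polyRing using (det; signed; det-cong; det-conj-injective)
  open import Algebra.Properties.Semiring.Sum (CommutativeRing.semiring polyRing) using (sum)

  sign≡signed : ∀ k p → sign k p ≡ signed k p
  sign≡signed zero          p = ≡.refl
  sign≡signed (suc zero)    p = ≡.refl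
  sign≡signed (suc (suc k)) p = sign≡signed k p

  sumFinₚ≡sum : ∀ {f g : Fin n → Poly} → (∀ i → f i ≡ g i) → sumFinₚ f ≡ sum g
  sumFinₚ≡sum {zero}  f≡g = ≡.refl
  sumFinₚ≡sum {suc n} f≡g = ≡.cong₂ _+ₚ_ (f≡g zero) (sumFinₚ≡sum (f≡g ∘ suc))

  detₚ≡det : (M : Mat Poly n) → detₚ M ≡ det M
  detₚ≡det {zero}  M = ≡.refl
  detₚ≡det {suc n} M = sumFinₚ≡sum λ j →
    ≡.trans (sign≡signed (toℕ j) _) (≡.cong (λ x → signed (toℕ j) (M zero j *ₚ x)) (detₚ≡det (minor M j)))

  -- charPoly builds X·I from a function local to its definition; unification names it here.
  charPoly-unfold : (M : Mat Carrier n) → Σ[ XI ∈ Mat Poly n ] charPoly M ≡ detₚ (λ i j → XI i j +ₚ -ₚ constₚ (M i j))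
  charPoly-unfold M = _ , ≡.refl

  XI : Mat Carrier n → Mat Poly n
  XI M = proj₁ (charPoly-unfold M)

  XI-diagonal : (M : Mat Carrier n) {i j : Fin n} → i ≡ j → XI M i j ≡ Xₚ
  XI-diagonal M {i} {j} i≡j with i ≟ j
  ... | yes _   = ≡.refl
  ... | no i≢j  = ⊥-elim (i≢j i≡j)

  XI-offDiagonal : (M : Mat Carrier n) {i j : Fin n} → i ≢ j → XI M i j ≡ 0ₚ
  XI-offDiagonal M {i} {j} i≢j with i ≟ j
  ... | yes i≡j = ⊥-elim (i≢j i≡j)
  ... | no _    = ≡.refl

  charPoly-conj : (σ : Fin (suc n) → Fin (suc n)) → Injective _≡_ _≡_ σ → (M N : Mat Carrier (suc n)) →
                  (∀ i j → M i j ≈ N (σ i) (σ j)) → charPoly M ≃ charPoly N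
  charPoly-conj σ σ-injective M N M≈N = begin
    charPoly M                                          ≡⟨ detₚ≡det (λ i j → XI M i j +ₚ -ₚ constₚ (M i j)) ⟩
    det (λ i j → XI M i j +ₚ -ₚ constₚ (M i j))         ≈⟨ det-cong entry ⟩
    det (λ i j → XI N (σ i) (σ j) +ₚ -ₚ constₚ (N (σ i) (σ j)))
                                                        ≈⟨ det-conj-injective σ σ-injective (λ i j → XI N i j +ₚ -ₚ constₚ (N i j)) ⟩
    det (λ i j → XI N i j +ₚ -ₚ constₚ (N i j))         ≡⟨ detₚ≡det (λ i j → XI N i j +ₚ -ₚ constₚ (N i j)) ⟨
    charPoly N                                          ∎
    where
    open import Relation.Binary.Reasoning.Setoid ≃-setoid
    diagonal-conj : ∀ i j → Dec (i ≡ j) → XI M i j ≡ XI N (σ i) (σ j)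
    diagonal-conj i j (yes i≡j) = ≡.trans (XI-diagonal M i≡j) (≡.sym (XI-diagonal N (≡.cong σ i≡j)))
    diagonal-conj i j (no  i≢j) = ≡.trans (XI-offDiagonal M i≢j) (≡.sym (XI-offDiagonal N (i≢j ∘ σ-injective)))
    entry : ∀ i j → XI M i j +ₚ -ₚ constₚ (M i j) ≃ XI N (σ i) (σ j) +ₚ -ₚ constₚ (N (σ i) (σ j))
    entry i j = +ₚ-cong (≡⇒≃ (diagonal-conj i j (i ≟ j))) (∷-cong (-‿cong (M≈N i j)) ≃-refl)

module DComposition {c ℓ : Level} (K : CommutativeRing c ℓ) where
  open CommutativeRing K hiding (zero)
  open MatrixOps K using (sumFin; dComp)
  open import Algebra.Properties.Semiring.Sum semiring using (sum; sum-cong-≋)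
  open Determinant K using (sum-reindex)

  sumFin≡sum : ∀ {f g : Fin n → Carrier} → (∀ i → f i ≡ g i) → sumFin f ≡ sum g
  sumFin≡sum {zero}  f≡g = ≡.refl
  sumFin≡sum {suc n} f≡g = ≡.cong₂ _+_ (f≡g zero) (sumFin≡sum (f≡g ∘ suc))

  sumFin²≡sum² : ∀ {m} (f : Fin m → Fin n → Carrier) → sumFin (λ s → sumFin (f s)) ≡ sum (λ s → sum (f s))
  sumFin²≡sum² f = sumFin≡sum λ s → sumFin≡sum {f = f s} λ t → ≡.refl

  module _ (S : ℕ) (d d′ : Fin (suc S)) (inverse : Modular._≡ₘ_ S (toℕ d ℕ.* toℕ d′) 1) where
    open AffineReindexing S d d′ inverse
    open import Relation.Binary.Reasoning.Setoid setoid

    dComp-conj : (A B : Mat Carrier (suc S)) → ∀ i j → dComp d B A i j ≈ dComp d′ A B (negMul d′ i) (negMul d′ j)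
    dComp-conj A B i j = begin
      dComp d B A i j
        ≡⟨ sumFin²≡sum² (λ s t → B s t * A (shift i s) (shift j t)) ⟩
      sum (λ s → sum λ t → B s t * A (shift i s) (shift j t))
        ≈⟨ sum-cong-≋ (λ s → sum-cong-≋ λ t → trans (*-comm (B s t) (A (shift i s) (shift j t)))
             (*-congˡ (reflexive (≡.cong₂ B (≡.sym (unshift-shift i s)) (≡.sym (unshift-shift j t)))))) ⟩
      sum (λ s → sum λ t → A (shift i s) (shift j t) * B (unshift i (shift i s)) (unshift j (shift j t)))
        ≈⟨ sum-cong-≋ (λ s → sum-reindex (λ v → A (shift i s) v * B (unshift i (shift i s)) (unshift j v))
                                          (shift j) (unshift j) (shift-unshift j) (unshift-shift j)) ⟨
      sum (λ s → sum λ v → A (shift i s) v * B (unshift i (shift i s)) (unshift j v))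
        ≈⟨ sum-reindex (λ u → sum λ v → A u v * B (unshift i u) (unshift j v))
                       (shift i) (unshift i) (shift-unshift i) (unshift-shift i) ⟨
      sum (λ u → sum λ v → A u v * B (unshift i u) (unshift j v))
        ≡⟨ sumFin²≡sum² (λ u v → A u v * B (unshift i u) (unshift j v)) ⟨
      dComp d′ A B (negMul d′ i) (negMul d′ j) ∎

corollary3p2 : {c ℓ : Level} (K : CommutativeRing c ℓ) → IsField K → CharZero K →
               (e : ℕ) .{{_ : NonZero e}} → 2 ≤ e →
               (A B : Mat (CommutativeRing.Carrier K) e) →
               (d d⁻¹ : Fin e) → MatrixOps.IsInverseMod K d d⁻¹ →
               MatrixOps._≈ₚ_ K
                 (MatrixOps.charPoly K (MatrixOps.dComp K d B A))
                 (MatrixOps.charPoly K (MatrixOps.dComp K d⁻¹ A B))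
corollary3p2 K _ _ (suc S) _ A B d d⁻¹ d⁻¹-inverse =
  ≃⇒≈ₚ (charPoly-conj (negMul d⁻¹) negMul-injective (dComp d B A) (dComp d⁻¹ A B) (dComp-conj S d d⁻¹ inverse A B))
  where
  open MatrixOps K using (dComp)
  open Polynomial K using (≃⇒≈ₚ)
  open CharacteristicPolynomial K using (charPoly-conj)
  open DComposition K using (dComp-conj)
  inverse = Modular.toℕ-mod≡1⇒≡ₘ1 S (toℕ d ℕ.* toℕ d⁻¹) d⁻¹-inverse
  open AffineReindexing S d d⁻¹ inverse using (negMul; negMul-injective)
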